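{- Let $\kappa\ge2$ be a constant such that for every $d'\ge1$, every formula $\psi(x,y_1,\dots,y_m)\in\mathrm{FO}[\exists^{(q,p)}x]$ of quantifier depth at most $d'$ with free variables among $x,y_1,\dots,y_m$, every $M\ge1$ and all integers $k_1,\dots,k_m$ with $|k_i|\le M$, the sentence $\exists x\colon\psi(x,k_1,\dots,k_m)$ holds iff $\psi(k,k_1,\dots,k_m)$ holds for some $k\in\mathbb{Z}$ with $|k|\le2^{\max\mathbf{P}(\psi)^{\kappa^{d'}}}\cdot\max\textsc{Const}(\psi)\cdot M\cdot\max\{1,m\}$. Let $d\ge1$, let $\varphi(x,y_1,\dots,y_\ell)\in\mathrm{FO}[\exists^{(q,p)}x]$ have quantifier depth at most $d$ and free variables among $x,y_1,\dots,y_\ell$, let $N\ge1$ and $n_1,\dots,n_\ell\in\mathbb{Z}$ with $|n_i|\le N$. Suppose there are only finitely many $n\in\mathbb{Z}$ such that $\varphi(n,n_1,\dots,n_\ell)$ holds. Then every $n\in\mathbb{Z}$ such that $\varphi(n,n_1,\dots,n_\ell)$ holds satisfies \[|n|\le2^{\max\mathbf{P}(\varphi)^{\kappa^{d+1}}}\cdot\max\textsc{Const}(\varphi)\cdot N\cdot\max\{1,\ell\}.\]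
   Context: Formulas are interpreted over $\mathbb{Z}$ with all integer constants, $+$, $<$ and $\equiv_k$ ($k\ge2$; $m\equiv_k n$ iff $k\mid m-n$). Terms are built from variables and integer constants by addition and multiplication by integers; each has a unique normal form $a_1x_{i_1}+\dots+a_nx_{i_n}+c$ with $i_1<\dots<i_n$, $a_j\neq0$ (coefficients $a_j$, constant $c$). Atomic formulas: $s<t$, $s\equiv_k t$ ($k\ge1$). $\mathrm{FO}[\exists^{(q,p)}x]$: formulas built from atomic formulas using $\neg,\land,\lor,\to,\leftrightarrow$, $\exists y$, and $\exists^{(q,p)}y$ ($y$ a single variable, $q$ a natural number, $p\ge2$), where $\exists^{(q,p)}y\,\varphi$ holds iff the set of integers $a$ making $\varphi$ true with $y$ set to $a$ is finite with cardinality congruent to $q$ modulo $p$. $\varphi(n,n_1,\dots,n_\ell)$ denotes $\varphi$ with $x,y_1,\dots,y_\ell$ replaced by integers. Quantifier depth: $0$ for atomic, unchanged by $\neg$, maximum for binary connectives, $+1$ per quantifier. $\textsc{Coeff}(\varphi)$: $0,\pm1,\pm2$ and $\pm a$ for $a$ a coefficient of the normal form of $s_1-s_2$ for an atomic subformula $s_1<s_2$; $\textsc{Const}(\varphi)$: $0,\pm1,\pm2$ and $\pm c$ for $c$ the constant of such $s_1-s_2$; $\textsc{Mod}(\varphi)$: $1$ and all $k$ with an atomic subformula $s_1\equiv_k s_2$ or a quantifier $\exists^{(q,k)}$ in $\varphi$; $\mathbf{P}(\varphi)=\textsc{Coeff}(\varphi)\cup\textsc{Mod}(\varphi)$. -}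

module Defs where

open import Data.Nat as ℕ using (ℕ; zero; suc; _≡ᵇ_)
open import Data.Integer as ℤ using (ℤ; +_; _-_; -_; _<_; _⊔_)
open import Data.Integer.Divisibility using (_∣_)
open import Data.Bool using (if_then_else_)
open import Data.List using (List; []; _∷_; _++_; map; concatMap; filter; length; foldr)
open import Data.List.Relation.Unary.Unique.Propositional using (Unique)
open import Data.List.Membership.Propositional using (_∈_)
open import Data.Vec using (Vec; []; _∷_)
open import Data.Product using (Σ; _×_; _,_)
open import Data.Sum using (_⊎_)
open import Data.Empty using (⊥)
open import Relation.Nullary using (¬_)
open import Relation.Nullary.Decidable using (¬?)
open import Relation.Binary.PropositionalEquality using (_≡_)

data Term : Set where
  var   : ℕ → Term
  const : ℤ → Term
  _⊕_   : Term → Term → Term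
  _⊛_   : ℤ → Term → Term

tvars : Term → List ℕ
tvars (var v)   = v ∷ []
tvars (const c) = []
tvars (s ⊕ t)   = tvars s ++ tvars t
tvars (a ⊛ t)   = tvars t

coef : Term → ℕ → ℤ
coef (var v)   w = if v ≡ᵇ w then + 1 else + 0
coef (const c) w = + 0
coef (s ⊕ t)   w = coef s w ℤ.+ coef t w
coef (a ⊛ t)   w = a ℤ.* coef t w

cst : Term → ℤ
cst (var v)   = + 0
cst (const c) = c
cst (s ⊕ t)   = cst s ℤ.+ cst t
cst (a ⊛ t)   = a ℤ.* cst t

nfCoeffs : Term → Term → List ℤ
nfCoeffs s₁ s₂ =
  filter (λ a → ¬? (a ℤ.≟ + 0))
         (map (λ w → coef s₁ w - coef s₂ w) (tvars s₁ ++ tvars s₂))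

nfConst : Term → Term → ℤ
nfConst s₁ s₂ = cst s₁ - cst s₂

evalT : (ℕ → ℤ) → Term → ℤ
evalT ρ (var v)   = ρ v
evalT ρ (const c) = c
evalT ρ (s ⊕ t)   = evalT ρ s ℤ.+ evalT ρ t
evalT ρ (a ⊛ t)   = a ℤ.* evalT ρ t

data Formula : Set where
  _<'_    : Term → Term → Formula
  cong'   : (s t : Term) (k : ℕ) → 1 ℕ.≤ k → Formula
  ¬'_     : Formula → Formula
  _∧'_    : Formula → Formula → Formula
  _∨'_    : Formula → Formula → Formula
  _⇒'_    : Formula → Formula → Formula
  _⇔'_    : Formula → Formula → Formula
  ∃'      : ℕ → Formula → Formula
  ∃cnt    : (q p : ℕ) → 2 ℕ.≤ p → ℕ → Formula → Formula

fv : Formula → List ℕ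
fv (s <' t)         = tvars s ++ tvars t
fv (cong' s t k _)  = tvars s ++ tvars t
fv (¬' φ)           = fv φ
fv (φ ∧' ψ)         = fv φ ++ fv ψ
fv (φ ∨' ψ)         = fv φ ++ fv ψ
fv (φ ⇒' ψ)         = fv φ ++ fv ψ
fv (φ ⇔' ψ)         = fv φ ++ fv ψ
fv (∃' y φ)         = filter (λ v → ¬? (v ℕ.≟ y)) (fv φ)
fv (∃cnt q p _ y φ) = filter (λ v → ¬? (v ℕ.≟ y)) (fv φ)

qd : Formula → ℕ
qd (s <' t)         = 0
qd (cong' s t k _)  = 0
qd (¬' φ)           = qd φ
qd (φ ∧' ψ)         = qd φ ℕ.⊔ qd ψ
qd (φ ∨' ψ)         = qd φ ℕ.⊔ qd ψ
qd (φ ⇒' ψ)         = qd φ ℕ.⊔ qd ψ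
qd (φ ⇔' ψ)         = qd φ ℕ.⊔ qd ψ
qd (∃' y φ)         = suc (qd φ)
qd (∃cnt q p _ y φ) = suc (qd φ)

-- Coeff, Const, Mod, P (as finite lists of their elements)

pm : ℤ → List ℤ
pm a = a ∷ - a ∷ []

coeffAtoms : Formula → List ℤ
coeffAtoms (s <' t)         = concatMap pm (nfCoeffs s t)
coeffAtoms (cong' s t k _)  = []
coeffAtoms (¬' φ)           = coeffAtoms φ
coeffAtoms (φ ∧' ψ)         = coeffAtoms φ ++ coeffAtoms ψ
coeffAtoms (φ ∨' ψ)         = coeffAtoms φ ++ coeffAtoms ψ
coeffAtoms (φ ⇒' ψ)         = coeffAtoms φ ++ coeffAtoms ψ
coeffAtoms (φ ⇔' ψ)         = coeffAtoms φ ++ coeffAtoms ψ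
coeffAtoms (∃' y φ)         = coeffAtoms φ
coeffAtoms (∃cnt q p _ y φ) = coeffAtoms φ

constAtoms : Formula → List ℤ
constAtoms (s <' t)         = pm (nfConst s t)
constAtoms (cong' s t k _)  = []
constAtoms (¬' φ)           = constAtoms φ
constAtoms (φ ∧' ψ)         = constAtoms φ ++ constAtoms ψ
constAtoms (φ ∨' ψ)         = constAtoms φ ++ constAtoms ψ
constAtoms (φ ⇒' ψ)         = constAtoms φ ++ constAtoms ψ
constAtoms (φ ⇔' ψ)         = constAtoms φ ++ constAtoms ψ
constAtoms (∃' y φ)         = constAtoms φ
constAtoms (∃cnt q p _ y φ) = constAtoms φ

modAtoms : Formula → List ℕ
modAtoms (s <' t)         = []
modAtoms (cong' s t k _)  = k ∷ []
modAtoms (¬' φ)           = modAtoms φ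
modAtoms (φ ∧' ψ)         = modAtoms φ ++ modAtoms ψ
modAtoms (φ ∨' ψ)         = modAtoms φ ++ modAtoms ψ
modAtoms (φ ⇒' ψ)         = modAtoms φ ++ modAtoms ψ
modAtoms (φ ⇔' ψ)         = modAtoms φ ++ modAtoms ψ
modAtoms (∃' y φ)         = modAtoms φ
modAtoms (∃cnt q p _ y φ) = p ∷ modAtoms φ

base : List ℤ
base = + 0 ∷ + 1 ∷ - + 1 ∷ + 2 ∷ - + 2 ∷ []

Coeff : Formula → List ℤ
Coeff φ = base ++ coeffAtoms φ

Const : Formula → List ℤ
Const φ = base ++ constAtoms φ

Mod : Formula → List ℕ
Mod φ = 1 ∷ modAtoms φ

P : Formula → List ℤ
P φ = Coeff φ ++ map +_ (Mod φ)

-- maximum of a list of integers containing 0 (all lists above contain 0)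
maxL : List ℤ → ℤ
maxL = foldr _⊔_ (+ 0)

_[_↦_] : (ℕ → ℤ) → ℕ → ℤ → (ℕ → ℤ)
(ρ [ y ↦ a ]) w = if w ≡ᵇ y then a else ρ w

FinCard : (ℤ → Set) → ℕ → Set
FinCard Q c = Σ (List ℤ) λ L → Unique L × (∀ a → (a ∈ L → Q a) × (Q a → a ∈ L)) × length L ≡ c

⟦_⟧ : Formula → (ℕ → ℤ) → Set
⟦ s <' t ⟧ ρ         = evalT ρ s < evalT ρ t
⟦ cong' s t k _ ⟧ ρ  = + k ∣ (evalT ρ s - evalT ρ t)
⟦ ¬' φ ⟧ ρ           = ¬ ⟦ φ ⟧ ρ
⟦ φ ∧' ψ ⟧ ρ         = ⟦ φ ⟧ ρ × ⟦ ψ ⟧ ρ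
⟦ φ ∨' ψ ⟧ ρ         = ⟦ φ ⟧ ρ ⊎ ⟦ ψ ⟧ ρ
⟦ φ ⇒' ψ ⟧ ρ         = ⟦ φ ⟧ ρ → ⟦ ψ ⟧ ρ
⟦ φ ⇔' ψ ⟧ ρ         = (⟦ φ ⟧ ρ → ⟦ ψ ⟧ ρ) × (⟦ ψ ⟧ ρ → ⟦ φ ⟧ ρ)
⟦ ∃' y φ ⟧ ρ         = Σ ℤ λ a → ⟦ φ ⟧ (ρ [ y ↦ a ])
⟦ ∃cnt q p _ y φ ⟧ ρ =
  Σ ℕ λ c → FinCard (λ a → ⟦ φ ⟧ (ρ [ y ↦ a ])) c × (+ p ∣ (+ c - + q))

-- assignment for φ(n, n₁, …, n_ℓ): x = variable 0, yᵢ = variable i;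
-- other variables get 0 (irrelevant when the free variables are among x, y₁..y_ℓ)
env : ∀ {m} → ℤ → Vec ℤ m → ℕ → ℤ
env n ks zero = n
env n [] (suc i) = + 0
env n (k ∷ ks) (suc zero) = k
env n (k ∷ ks) (suc (suc i)) = env n ks (suc i)

bound : Formula → ℕ → ℕ → ℕ → ℕ
bound φ e N m =
  2 ℕ.^ (ℤ.∣ maxL (P φ) ∣ ℕ.^ e) ℕ.* ℤ.∣ maxL (Const φ) ∣ ℕ.* N ℕ.* (1 ℕ.⊔ m)

-- Let ψ(x, ȳ) say that x solves φ(·, ȳ) and no solution lies strictly beyond x in a fixed
-- direction (up or down).  ψ has depth d + 1 and the same P and Const as φ: comparing x with a
-- fresh variable only contributes coefficients ±1 and constant 0.  A finite solution set that
-- contains n has an extremal element in the direction of the sign of n, so ∃x ψ holds, and the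
-- hypothesis at depth d + 1 yields an extremal solution k within the bound; as n is not beyond k,
-- |n| ≤ |k|.  The extremal element is only obtained under a double negation, which is harmless
-- because the conclusion is a decidable inequality.
module Submission where

open import Defs
open import Data.Nat as ℕ using (ℕ; zero; suc; _≡ᵇ_; _≤_; _^_; z≤n; s≤s)
import Data.Nat.Properties as ℕP
open import Data.Integer as ℤ using (ℤ; +_; -[1+_]; 0ℤ; ∣_∣; +≤+; -≤-)
import Data.Integer.Properties as ℤP
open import Data.Integer.Divisibility using (_∣_)
open import Data.Sign using (Sign)
open import Data.Bool using (true; false; if_then_else_)
open import Data.Vec using (Vec; []; _∷_)
open import Data.Vec.Relation.Unary.All using (All)
open import Data.List using (List; []; _∷_; _++_; map; filter; concatMap)
open import Data.List.Properties using (map-++; map-∘; map-cong)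
open import Data.List.Relation.Unary.All as L using ()
open import Data.List.Relation.Unary.All.Properties using () renaming (++⁺ to All-++⁺)
open import Data.List.Relation.Unary.Any using (here; there)
open import Data.List.Membership.Propositional using (_∈_)
open import Data.List.Membership.Propositional.Properties
  using (∈-++⁺ˡ; ∈-++⁺ʳ; ∈-++⁻; ∈-filter⁺; ∈-filter⁻; ∈-map⁺; ∈-map⁻)
open import Data.List.Relation.Binary.Subset.Propositional using (_⊆_)
open import Data.List.Relation.Binary.Subset.Propositional.Properties
  using (⊆-refl; ⊆-trans; ⊆-reflexive; xs⊆xs++ys; xs⊆ys++xs; ++⁺; ++⁺ʳ; map⁺; ∷⁺ʳ)
open import Data.Product using (Σ; _×_; _,_; proj₁; proj₂)
open import Data.Product.Function.NonDependent.Propositional using (_×-⇔_)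
open import Data.Product.Function.Dependent.Propositional using (Σ-⇔)
open import Data.Sum using (_⊎_; inj₁; inj₂; [_,_]; map₁)
open import Data.Sum.Function.Propositional using (_⊎-⇔_)
open import Function using (_∘_; id; flip)
open import Function.Bundles using (_⇔_; mk⇔; Equivalence)
open import Function.Construct.Identity using (↠-id)
open import Function.Definitions using (Injective)
open import Function.Properties.Equivalence using () renaming (refl to ⇔-refl; sym to ⇔-sym)
open import Function.Related.TypeIsomorphisms using (→-cong-⇔; ¬-cong-⇔)
open import Relation.Nullary using (¬_; Dec; yes; no; contradiction)
open import Relation.Nullary.Negation using (¬¬-Monad)
open import Relation.Binary.Definitions using (Transitive)
open import Effect.Monad using (RawMonad)
open import Level using (0ℓ)
open import Relation.Nullary.Decidable
  using (¬?; dec-true; dec-false; decidable-stable; ¬¬-excluded-middle)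
open import Relation.Binary.PropositionalEquality
  using (_≡_; _≢_; refl; sym; trans; cong; cong₂; subst; module ≡-Reasoning)

≡ᵇ-refl : ∀ n → (n ≡ᵇ n) ≡ true
≡ᵇ-refl n = dec-true (n ℕ.≟ n) refl

≡ᵇ-≢ : ∀ {m n} → m ≢ n → (m ≡ᵇ n) ≡ false
≡ᵇ-≢ {m} {n} = dec-false (m ℕ.≟ n)

≡ᵇ-injective : ∀ {r : ℕ → ℕ} → Injective _≡_ _≡_ r → ∀ v w → (r v ≡ᵇ r w) ≡ (v ≡ᵇ w)
≡ᵇ-injective {r} inj v w with v ℕ.≟ w
... | yes refl = trans (≡ᵇ-refl (r v)) (sym (≡ᵇ-refl v))
... | no v≢w = trans (≡ᵇ-≢ (v≢w ∘ inj)) (sym (≡ᵇ-≢ v≢w))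

update-≡ : ∀ ρ {y a} → (ρ [ y ↦ a ]) y ≡ a
update-≡ ρ {y} rewrite ≡ᵇ-refl y = refl

update-≢ : ∀ ρ {y a w} → w ≢ y → (ρ [ y ↦ a ]) w ≡ ρ w
update-≢ ρ w≢y rewrite ≡ᵇ-≢ w≢y = refl

update-rename : ∀ {r : ℕ → ℕ} → Injective _≡_ _≡_ r → ∀ {ρ σ y xs} →
  (∀ {v} → v ∈ filter (λ v → ¬? (v ℕ.≟ y)) xs → σ v ≡ ρ (r v)) →
  ∀ a {v} → v ∈ xs → (σ [ y ↦ a ]) v ≡ (ρ [ r y ↦ a ]) (r v)
update-rename {r} inj {ρ} {σ} {y} agree a {v} v∈ with v ℕ.≟ y
... | yes refl = trans (update-≡ σ) (sym (update-≡ ρ {r y}))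
... | no v≢y = trans (update-≢ σ {a = a} v≢y)
  (trans (agree (∈-filter⁺ (λ v → ¬? (v ℕ.≟ y)) v∈ v≢y)) (sym (update-≢ ρ {r y} (v≢y ∘ inj))))

renameTerm : (ℕ → ℕ) → Term → Term
renameTerm r (var v)   = var (r v)
renameTerm r (const c) = const c
renameTerm r (s ⊕ t)   = renameTerm r s ⊕ renameTerm r t
renameTerm r (a ⊛ t)   = a ⊛ renameTerm r t

-- Bound variables are renamed too, so an injective r never captures a variable.
rename : (ℕ → ℕ) → Formula → Formula
rename r (s <' t)            = renameTerm r s <' renameTerm r t
rename r (cong' s t k k≥1)   = cong' (renameTerm r s) (renameTerm r t) k k≥1
rename r (¬' φ)              = ¬' rename r φ
rename r (φ ∧' ψ)            = rename r φ ∧' rename r ψ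
rename r (φ ∨' ψ)            = rename r φ ∨' rename r ψ
rename r (φ ⇒' ψ)            = rename r φ ⇒' rename r ψ
rename r (φ ⇔' ψ)            = rename r φ ⇔' rename r ψ
rename r (∃' y φ)            = ∃' (r y) (rename r φ)
rename r (∃cnt q p p≥2 y φ)  = ∃cnt q p p≥2 (r y) (rename r φ)

module _ {r : ℕ → ℕ} where

  evalT-rename : ∀ {ρ σ} s → (∀ {v} → v ∈ tvars s → σ v ≡ ρ (r v)) →
    evalT ρ (renameTerm r s) ≡ evalT σ s
  evalT-rename (var v)   agree = sym (agree (here refl))
  evalT-rename (const c) agree = refl
  evalT-rename (s ⊕ t)   agree =
    cong₂ ℤ._+_ (evalT-rename s (agree ∘ ∈-++⁺ˡ)) (evalT-rename t (agree ∘ ∈-++⁺ʳ (tvars s)))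
  evalT-rename (a ⊛ t)   agree = cong (a ℤ.*_) (evalT-rename t agree)

  tvars-rename : ∀ s → tvars (renameTerm r s) ≡ map r (tvars s)
  tvars-rename (var v)   = refl
  tvars-rename (const c) = refl
  tvars-rename (s ⊕ t)   =
    trans (cong₂ _++_ (tvars-rename s) (tvars-rename t)) (sym (map-++ r (tvars s) (tvars t)))
  tvars-rename (a ⊛ t)   = tvars-rename t

  cst-rename : ∀ s → cst (renameTerm r s) ≡ cst s
  cst-rename (var v)   = refl
  cst-rename (const c) = refl
  cst-rename (s ⊕ t)   = cong₂ ℤ._+_ (cst-rename s) (cst-rename t)
  cst-rename (a ⊛ t)   = cong (a ℤ.*_) (cst-rename t)

  coef-rename : Injective _≡_ _≡_ r → ∀ s w → coef (renameTerm r s) (r w) ≡ coef s w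
  coef-rename inj (var v) w   = cong (if_then + 1 else + 0) (≡ᵇ-injective inj v w)
  coef-rename inj (const c) w = refl
  coef-rename inj (s ⊕ t) w   = cong₂ ℤ._+_ (coef-rename inj s w) (coef-rename inj t w)
  coef-rename inj (a ⊛ t) w   = cong (a ℤ.*_) (coef-rename inj t w)

  tvars-++-rename : ∀ s t →
    tvars (renameTerm r s) ++ tvars (renameTerm r t) ≡ map r (tvars s ++ tvars t)
  tvars-++-rename s t =
    trans (cong₂ _++_ (tvars-rename s) (tvars-rename t)) (sym (map-++ r (tvars s) (tvars t)))

  nfCoeffs-rename : Injective _≡_ _≡_ r → ∀ s t →
    nfCoeffs (renameTerm r s) (renameTerm r t) ≡ nfCoeffs s t
  nfCoeffs-rename inj s t = cong (filter (λ a → ¬? (a ℤ.≟ + 0))) (begin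
    map difference′ (tvars (renameTerm r s) ++ tvars (renameTerm r t))
      ≡⟨ cong (map difference′) (tvars-++-rename s t) ⟩
    map difference′ (map r (tvars s ++ tvars t))
      ≡⟨ sym (map-∘ (tvars s ++ tvars t)) ⟩
    map (difference′ ∘ r) (tvars s ++ tvars t)
      ≡⟨ map-cong (λ w → cong₂ ℤ._-_ (coef-rename inj s w) (coef-rename inj t w)) _ ⟩
    map difference (tvars s ++ tvars t) ∎)
    where
    open ≡-Reasoning
    difference′ difference : ℕ → ℤ
    difference′ w = coef (renameTerm r s) w ℤ.- coef (renameTerm r t) w
    difference  w = coef s w ℤ.- coef t w

  qd-rename : ∀ φ → qd (rename r φ) ≡ qd φ
  qd-rename (s <' t)         = refl
  qd-rename (cong' s t k _)  = refl
  qd-rename (¬' φ)           = qd-rename φ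
  qd-rename (φ ∧' ψ)         = cong₂ ℕ._⊔_ (qd-rename φ) (qd-rename ψ)
  qd-rename (φ ∨' ψ)         = cong₂ ℕ._⊔_ (qd-rename φ) (qd-rename ψ)
  qd-rename (φ ⇒' ψ)         = cong₂ ℕ._⊔_ (qd-rename φ) (qd-rename ψ)
  qd-rename (φ ⇔' ψ)         = cong₂ ℕ._⊔_ (qd-rename φ) (qd-rename ψ)
  qd-rename (∃' y φ)         = cong suc (qd-rename φ)
  qd-rename (∃cnt q p _ y φ) = cong suc (qd-rename φ)

  ++-⊆-map : ∀ {xs ys us vs} → xs ⊆ map r us → ys ⊆ map r vs → xs ++ ys ⊆ map r (us ++ vs)
  ++-⊆-map {us = us} {vs} xs⊆ ys⊆ = ⊆-trans (++⁺ xs⊆ ys⊆) (⊆-reflexive (sym (map-++ r us vs)))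

  filter-⊆-map : ∀ {y xs us} → xs ⊆ map r us →
    filter (λ v → ¬? (v ℕ.≟ r y)) xs ⊆ map r (filter (λ v → ¬? (v ℕ.≟ y)) us)
  filter-⊆-map {y} {xs} xs⊆ v∈ with ∈-filter⁻ (λ v → ¬? (v ℕ.≟ r y)) {xs = xs} v∈
  ... | v∈xs , v≢ry with ∈-map⁻ r (xs⊆ v∈xs)
  ...   | u , u∈ , refl = ∈-map⁺ r (∈-filter⁺ (λ v → ¬? (v ℕ.≟ y)) u∈ (λ u≡y → v≢ry (cong r u≡y)))

  fv-rename : ∀ φ → fv (rename r φ) ⊆ map r (fv φ)
  fv-rename (s <' t)          = ⊆-reflexive (tvars-++-rename s t)
  fv-rename (cong' s t k _)   = ⊆-reflexive (tvars-++-rename s t)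
  fv-rename (¬' φ)            = fv-rename φ
  fv-rename (φ ∧' ψ)          = ++-⊆-map (fv-rename φ) (fv-rename ψ)
  fv-rename (φ ∨' ψ)          = ++-⊆-map (fv-rename φ) (fv-rename ψ)
  fv-rename (φ ⇒' ψ)          = ++-⊆-map (fv-rename φ) (fv-rename ψ)
  fv-rename (φ ⇔' ψ)          = ++-⊆-map (fv-rename φ) (fv-rename ψ)
  fv-rename (∃' y φ)          = filter-⊆-map (fv-rename φ)
  fv-rename (∃cnt q p _ y φ)  = filter-⊆-map (fv-rename φ)

  constAtoms-rename : ∀ φ → constAtoms (rename r φ) ≡ constAtoms φ
  constAtoms-rename (s <' t)         = cong pm (cong₂ ℤ._-_ (cst-rename s) (cst-rename t))
  constAtoms-rename (cong' s t k _)  = refl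
  constAtoms-rename (¬' φ)           = constAtoms-rename φ
  constAtoms-rename (φ ∧' ψ)         = cong₂ _++_ (constAtoms-rename φ) (constAtoms-rename ψ)
  constAtoms-rename (φ ∨' ψ)         = cong₂ _++_ (constAtoms-rename φ) (constAtoms-rename ψ)
  constAtoms-rename (φ ⇒' ψ)         = cong₂ _++_ (constAtoms-rename φ) (constAtoms-rename ψ)
  constAtoms-rename (φ ⇔' ψ)         = cong₂ _++_ (constAtoms-rename φ) (constAtoms-rename ψ)
  constAtoms-rename (∃' y φ)         = constAtoms-rename φ
  constAtoms-rename (∃cnt q p _ y φ) = constAtoms-rename φ

  modAtoms-rename : ∀ φ → modAtoms (rename r φ) ≡ modAtoms φ
  modAtoms-rename (s <' t)         = refl
  modAtoms-rename (cong' s t k _)  = refl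
  modAtoms-rename (¬' φ)           = modAtoms-rename φ
  modAtoms-rename (φ ∧' ψ)         = cong₂ _++_ (modAtoms-rename φ) (modAtoms-rename ψ)
  modAtoms-rename (φ ∨' ψ)         = cong₂ _++_ (modAtoms-rename φ) (modAtoms-rename ψ)
  modAtoms-rename (φ ⇒' ψ)         = cong₂ _++_ (modAtoms-rename φ) (modAtoms-rename ψ)
  modAtoms-rename (φ ⇔' ψ)         = cong₂ _++_ (modAtoms-rename φ) (modAtoms-rename ψ)
  modAtoms-rename (∃' y φ)         = modAtoms-rename φ
  modAtoms-rename (∃cnt q p _ y φ) = cong (p ∷_) (modAtoms-rename φ)

  coeffAtoms-rename : Injective _≡_ _≡_ r → ∀ φ → coeffAtoms (rename r φ) ≡ coeffAtoms φ
  coeffAtoms-rename inj (s <' t)         = cong (concatMap pm) (nfCoeffs-rename inj s t)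
  coeffAtoms-rename inj (cong' s t k _)  = refl
  coeffAtoms-rename inj (¬' φ)           = coeffAtoms-rename inj φ
  coeffAtoms-rename inj (φ ∧' ψ)         = cong₂ _++_ (coeffAtoms-rename inj φ) (coeffAtoms-rename inj ψ)
  coeffAtoms-rename inj (φ ∨' ψ)         = cong₂ _++_ (coeffAtoms-rename inj φ) (coeffAtoms-rename inj ψ)
  coeffAtoms-rename inj (φ ⇒' ψ)         = cong₂ _++_ (coeffAtoms-rename inj φ) (coeffAtoms-rename inj ψ)
  coeffAtoms-rename inj (φ ⇔' ψ)         = cong₂ _++_ (coeffAtoms-rename inj φ) (coeffAtoms-rename inj ψ)
  coeffAtoms-rename inj (∃' y φ)         = coeffAtoms-rename inj φ
  coeffAtoms-rename inj (∃cnt q p _ y φ) = coeffAtoms-rename inj φ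

FinCard-map : ∀ {P Q : ℤ → Set} {c} → (∀ a → P a ⇔ Q a) → FinCard P c → FinCard Q c
FinCard-map P⇔Q (L , unique , members , length≡c) =
  L , unique , (λ a → Equivalence.to (P⇔Q a) ∘ proj₁ (members a) ,
                      proj₂ (members a) ∘ Equivalence.from (P⇔Q a)) , length≡c

FinCard-⇔ : ∀ {P Q : ℤ → Set} {c} → (∀ a → P a ⇔ Q a) → FinCard P c ⇔ FinCard Q c
FinCard-⇔ P⇔Q = mk⇔ (FinCard-map P⇔Q) (FinCard-map (⇔-sym ∘ P⇔Q))

≡⇒⇔ : ∀ {A B : Set} → A ≡ B → A ⇔ B
≡⇒⇔ refl = ⇔-refl

⟦rename⟧ : ∀ {r} → Injective _≡_ _≡_ r → ∀ φ {ρ σ} → (∀ {v} → v ∈ fv φ → σ v ≡ ρ (r v)) →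
  ⟦ rename r φ ⟧ ρ ⇔ ⟦ φ ⟧ σ
⟦rename⟧ inj (s <' t) agree =
  ≡⇒⇔ (cong₂ ℤ._<_ (evalT-rename s (agree ∘ ∈-++⁺ˡ)) (evalT-rename t (agree ∘ ∈-++⁺ʳ (tvars s))))
⟦rename⟧ inj (cong' s t k _) agree =
  ≡⇒⇔ (cong₂ (λ a b → + k ∣ (a ℤ.- b))
             (evalT-rename s (agree ∘ ∈-++⁺ˡ)) (evalT-rename t (agree ∘ ∈-++⁺ʳ (tvars s))))
⟦rename⟧ inj (¬' φ) agree = ¬-cong-⇔ (⟦rename⟧ inj φ agree)
⟦rename⟧ inj (φ ∧' ψ) agree =
  ⟦rename⟧ inj φ (agree ∘ ∈-++⁺ˡ) ×-⇔ ⟦rename⟧ inj ψ (agree ∘ ∈-++⁺ʳ (fv φ))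
⟦rename⟧ inj (φ ∨' ψ) agree =
  ⟦rename⟧ inj φ (agree ∘ ∈-++⁺ˡ) ⊎-⇔ ⟦rename⟧ inj ψ (agree ∘ ∈-++⁺ʳ (fv φ))
⟦rename⟧ inj (φ ⇒' ψ) agree =
  →-cong-⇔ (⟦rename⟧ inj φ (agree ∘ ∈-++⁺ˡ)) (⟦rename⟧ inj ψ (agree ∘ ∈-++⁺ʳ (fv φ)))
⟦rename⟧ {r} inj (φ ⇔' ψ) {ρ} {σ} agree = →-cong-⇔ φ⇔ ψ⇔ ×-⇔ →-cong-⇔ ψ⇔ φ⇔
  where
  φ⇔ : ⟦ rename r φ ⟧ ρ ⇔ ⟦ φ ⟧ σ
  φ⇔ = ⟦rename⟧ inj φ (agree ∘ ∈-++⁺ˡ)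
  ψ⇔ : ⟦ rename r ψ ⟧ ρ ⇔ ⟦ ψ ⟧ σ
  ψ⇔ = ⟦rename⟧ inj ψ (agree ∘ ∈-++⁺ʳ (fv φ))
⟦rename⟧ inj (∃' y φ) {ρ} {σ} agree =
  Σ-⇔ (↠-id ℤ) (λ {a} → ⟦rename⟧ inj φ (update-rename inj {ρ} {σ} agree a))
⟦rename⟧ inj (∃cnt q p _ y φ) {ρ} {σ} agree =
  Σ-⇔ (↠-id ℕ) (FinCard-⇔ (λ a → ⟦rename⟧ inj φ (update-rename inj {ρ} {σ} agree a)) ×-⇔ ⇔-refl)

renameTerm-id : ∀ s → renameTerm id s ≡ s
renameTerm-id (var v)   = refl
renameTerm-id (const c) = refl
renameTerm-id (s ⊕ t)   = cong₂ _⊕_ (renameTerm-id s) (renameTerm-id t)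
renameTerm-id (a ⊛ t)   = cong (a ⊛_) (renameTerm-id t)

rename-id : ∀ φ → rename id φ ≡ φ
rename-id (s <' t)           = cong₂ _<'_ (renameTerm-id s) (renameTerm-id t)
rename-id (cong' s t k k≥1)  = cong₂ (λ s t → cong' s t k k≥1) (renameTerm-id s) (renameTerm-id t)
rename-id (¬' φ)             = cong ¬'_ (rename-id φ)
rename-id (φ ∧' ψ)           = cong₂ _∧'_ (rename-id φ) (rename-id ψ)
rename-id (φ ∨' ψ)           = cong₂ _∨'_ (rename-id φ) (rename-id ψ)
rename-id (φ ⇒' ψ)           = cong₂ _⇒'_ (rename-id φ) (rename-id ψ)
rename-id (φ ⇔' ψ)           = cong₂ _⇔'_ (rename-id φ) (rename-id ψ)
rename-id (∃' y φ)           = cong (∃' y) (rename-id φ)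
rename-id (∃cnt q p p≥2 y φ) = cong (∃cnt q p p≥2 y) (rename-id φ)

⟦⟧-coincidence : ∀ φ {ρ σ} → (∀ {v} → v ∈ fv φ → σ v ≡ ρ v) → ⟦ φ ⟧ ρ ⇔ ⟦ φ ⟧ σ
⟦⟧-coincidence φ {ρ} {σ} agree =
  subst (λ χ → ⟦ χ ⟧ ρ ⇔ ⟦ φ ⟧ σ) (rename-id φ) (⟦rename⟧ {r = id} id φ agree)

env-suc : ∀ {m} x y (ns : Vec ℤ m) u → env x ns (suc u) ≡ env y ns (suc u)
env-suc x y []       u       = refl
env-suc x y (k ∷ ns) zero    = refl
env-suc x y (k ∷ ns) (suc u) = env-suc x y ns u

env-update₀ : ∀ {m} x a (ns : Vec ℤ m) v → (env x ns [ 0 ↦ a ]) v ≡ env a ns v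
env-update₀ x a ns zero    = refl
env-update₀ x a ns (suc u) = env-suc x a ns u

++-⊆ : ∀ {A : Set} {xs ys zs : List A} → xs ⊆ zs → ys ⊆ zs → xs ++ ys ⊆ zs
++-⊆ {xs = xs} xs⊆zs ys⊆zs v∈ = [ xs⊆zs , ys⊆zs ] (∈-++⁻ xs v∈)

++-absorb-⊆ : ∀ {A : Set} {xs ys zs : List A} → zs ⊆ xs → xs ++ (ys ++ (zs ++ ys)) ⊆ xs ++ ys
++-absorb-⊆ {xs = xs} {ys} zs⊆xs =
  ++-⊆ (xs⊆xs++ys xs ys)
       (++-⊆ (xs⊆ys++xs ys xs) (++-⊆ (⊆-trans zs⊆xs (xs⊆xs++ys xs ys)) (xs⊆ys++xs ys xs)))

maxL-nonneg : ∀ xs → + 0 ℤ.≤ maxL xs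
maxL-nonneg []       = ℤP.≤-refl
maxL-nonneg (x ∷ xs) = ℤP.i≤j⇒i≤k⊔j x (maxL-nonneg xs)

∈⇒≤maxL : ∀ {z xs} → z ∈ xs → z ℤ.≤ maxL xs
∈⇒≤maxL {xs = x ∷ xs} (here refl) = ℤP.i≤i⊔j x (maxL xs)
∈⇒≤maxL {xs = x ∷ xs} (there z∈)  = ℤP.i≤j⇒i≤k⊔j x (∈⇒≤maxL z∈)

maxL-lub : ∀ {m} xs → + 0 ℤ.≤ m → (∀ {z} → z ∈ xs → z ℤ.≤ m) → maxL xs ℤ.≤ m
maxL-lub []       0≤m ub = 0≤m
maxL-lub (x ∷ xs) 0≤m ub = ℤP.⊔-lub (ub (here refl)) (maxL-lub xs 0≤m (ub ∘ there))

maxL-mono-⊆ : ∀ {xs ys} → xs ⊆ ys → maxL xs ℤ.≤ maxL ys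
maxL-mono-⊆ {xs} {ys} xs⊆ys = maxL-lub xs (maxL-nonneg ys) (∈⇒≤maxL ∘ xs⊆ys)

maxL-cong-⊆ : ∀ {xs ys} → xs ⊆ ys → ys ⊆ xs → maxL xs ≡ maxL ys
maxL-cong-⊆ xs⊆ys ys⊆xs = ℤP.≤-antisym (maxL-mono-⊆ xs⊆ys) (maxL-mono-⊆ ys⊆xs)

Maximal : ∀ {A : Set} → (A → A → Set) → (A → Set) → A → Set
Maximal {A} _≺_ Q m = Q m × ¬ Σ A λ z → m ≺ z × Q z

module _ {A : Set} {_≺_ : A → A → Set} (≺-trans : Transitive _≺_) (≺-irrefl : ∀ {a} → ¬ a ≺ a)
         {Q : A → Set} where

  open RawMonad (¬¬-Monad {0ℓ})

  private
    MaximalIn : List A → A → Set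
    MaximalIn S m = Q m × (∀ {z} → z ∈ S → Q z → ¬ m ≺ z)

    extend : ∀ {s S m} → MaximalIn S m → Dec (Q s) → Dec (m ≺ s) → Σ A (MaximalIn (s ∷ S))
    extend {m = m} (qm , m-max) (no ¬qs) _ =
      m , qm , λ { (here refl) qs → contradiction qs ¬qs ; (there z∈) → m-max z∈ }
    extend {m = m} (qm , m-max) (yes _) (no m⊀s) =
      m , qm , λ { (here refl) _ → m⊀s ; (there z∈) → m-max z∈ }
    extend {s} (qm , m-max) (yes qs) (yes m≺s) =
      s , qs , λ { (here refl) _ → ≺-irrefl ; (there z∈) qz s≺z → m-max z∈ qz (≺-trans m≺s s≺z) }

    ¬¬-maximalIn : ∀ {n} → Q n → ∀ S → ¬ ¬ Σ A (MaximalIn S)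
    ¬¬-maximalIn {n} qn []      = pure (n , qn , λ ())
    ¬¬-maximalIn qn     (s ∷ S) = do
      (m , m-max) ← ¬¬-maximalIn qn S
      Qs? ← ¬¬-excluded-middle
      m≺s? ← ¬¬-excluded-middle
      pure (extend m-max Qs? m≺s?)

  ¬¬-maximal : ∀ {n} S → (∀ {z} → Q z → z ∈ S) → Q n → ¬ ¬ Σ A (Maximal _≺_ Q)
  ¬¬-maximal S cover qn = do
    (m , qm , m-max) ← ¬¬-maximalIn qn S
    pure (m , qm , λ (z , m≺z , qz) → m-max (cover qz) qz m≺z)

swap₀ : ℕ → ℕ → ℕ
swap₀ k zero    = suc k
swap₀ k (suc v) = if v ≡ᵇ k then zero else suc v

swap₀-fixes : ∀ {k v} → v ≢ k → swap₀ k (suc v) ≡ suc v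
swap₀-fixes v≢k rewrite ≡ᵇ-≢ v≢k = refl

swap₀-involutive : ∀ k v → swap₀ k (swap₀ k v) ≡ v
swap₀-involutive k zero rewrite ≡ᵇ-refl k = refl
swap₀-involutive k (suc v) with v ℕ.≟ k
... | yes refl rewrite ≡ᵇ-refl v = refl
... | no v≢k rewrite ≡ᵇ-≢ v≢k | ≡ᵇ-≢ v≢k = refl

swap₀-bounded : ∀ {ℓ u} → u ≤ ℓ → swap₀ ℓ u ≤ ℓ ⊎ swap₀ ℓ u ≡ suc ℓ
swap₀-bounded {u = zero} _ = inj₂ refl
swap₀-bounded {ℓ} {suc u} 1+u≤ℓ with u ℕ.≟ ℓ
... | yes refl = contradiction 1+u≤ℓ (ℕP.<-irrefl refl)
... | no u≢ℓ = inj₁ (subst (_≤ ℓ) (sym (swap₀-fixes u≢ℓ)) 1+u≤ℓ)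

swap₀-injective : ∀ k → Injective _≡_ _≡_ (swap₀ k)
swap₀-injective k {v} {w} eq =
  trans (sym (swap₀-involutive k v)) (trans (cong (swap₀ k) eq) (swap₀-involutive k w))

Beyond : Sign → ℤ → ℤ → Set
Beyond Sign.+ a b = a ℤ.< b
Beyond Sign.- a b = b ℤ.< a

beyond : Sign → Term → Term → Formula
beyond Sign.+ s t = s <' t
beyond Sign.- s t = t <' s

⟦beyond⟧ : ∀ dir s t ρ → ⟦ beyond dir s t ⟧ ρ ≡ Beyond dir (evalT ρ s) (evalT ρ t)
⟦beyond⟧ Sign.+ s t ρ = refl
⟦beyond⟧ Sign.- s t ρ = refl

Beyond-trans : ∀ dir → Transitive (Beyond dir)
Beyond-trans Sign.+ = ℤP.<-trans
Beyond-trans Sign.- = flip ℤP.<-trans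

Beyond-irrefl : ∀ dir {a} → ¬ Beyond dir a a
Beyond-irrefl Sign.+ = ℤP.<-irrefl refl
Beyond-irrefl Sign.- = ℤP.<-irrefl refl

¬Beyond⇒∣∣≤∣∣ : ∀ n {k} → ¬ Beyond (ℤ.sign n) k n → ∣ n ∣ ≤ ∣ k ∣
¬Beyond⇒∣∣≤∣∣ (+ u) k≮n with ℤP.≮⇒≥ k≮n
... | +≤+ u≤v = u≤v
¬Beyond⇒∣∣≤∣∣ -[1+ u ] n≮k with ℤP.≮⇒≥ n≮k
... | -≤- u≤v = s≤s u≤v

qd-beyond : ∀ dir s t → qd (beyond dir s t) ≡ 0
qd-beyond Sign.+ s t = refl
qd-beyond Sign.- s t = refl

fv-beyond : ∀ dir {w v} → v ∈ fv (beyond dir (var 0) (var w)) → v ≡ 0 ⊎ v ≡ w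
fv-beyond Sign.+ (here refl)         = inj₁ refl
fv-beyond Sign.+ (there (here refl)) = inj₂ refl
fv-beyond Sign.- (here refl)         = inj₂ refl
fv-beyond Sign.- (there (here refl)) = inj₁ refl

modAtoms-beyond : ∀ dir s t → modAtoms (beyond dir s t) ≡ []
modAtoms-beyond Sign.+ s t = refl
modAtoms-beyond Sign.- s t = refl

±1⊆base : (+ 1 ∷ -[1+ 0 ] ∷ -[1+ 0 ] ∷ + 1 ∷ []) ⊆ base
±1⊆base (here refl)                         = there (here refl)
±1⊆base (there (here refl))                 = there (there (here refl))
±1⊆base (there (there (here refl)))         = there (there (here refl))
±1⊆base (there (there (there (here refl)))) = there (here refl)

coeffAtoms-beyond : ∀ dir ℓ → coeffAtoms (beyond dir (var 0) (var (suc ℓ))) ⊆ base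
coeffAtoms-beyond Sign.+ ℓ rewrite ≡ᵇ-refl ℓ = ±1⊆base
coeffAtoms-beyond Sign.- ℓ rewrite ≡ᵇ-refl ℓ = ±1⊆base

constAtoms-beyond : ∀ dir v w → constAtoms (beyond dir (var v) (var w)) ⊆ base
constAtoms-beyond Sign.+ v w (here refl)         = here refl
constAtoms-beyond Sign.+ v w (there (here refl)) = here refl
constAtoms-beyond Sign.- v w (here refl)         = here refl
constAtoms-beyond Sign.- v w (there (here refl)) = here refl

-- The solution beyond x is the fresh variable suc ℓ; swap₀ ℓ moves x there in the copy of φ.
extremal : Sign → ℕ → Formula → Formula
extremal dir ℓ φ = φ ∧' (¬' ∃' (suc ℓ) (beyond dir (var 0) (var (suc ℓ)) ∧' rename (swap₀ ℓ) φ))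

qd-extremal : ∀ dir {ℓ d} φ → qd φ ≤ d → qd (extremal dir ℓ φ) ≤ suc d
qd-extremal dir {ℓ} φ qdφ≤d rewrite qd-beyond dir (var 0) (var (suc ℓ)) | qd-rename {swap₀ ℓ} φ =
  ℕP.⊔-lub (ℕP.m≤n⇒m≤1+n qdφ≤d) (s≤s qdφ≤d)

All-≤-filter-fresh : ∀ {ℓ xs} → (∀ {v} → v ∈ xs → v ≤ ℓ ⊎ v ≡ suc ℓ) →
  L.All (_≤ ℓ) (filter (λ v → ¬? (v ℕ.≟ suc ℓ)) xs)
All-≤-filter-fresh {ℓ} {xs} bounded-or-fresh = L.tabulate λ v∈ →
  let v∈xs , v≢fresh = ∈-filter⁻ (λ v → ¬? (v ℕ.≟ suc ℓ)) {xs = xs} v∈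
  in [ id , (λ v≡fresh → contradiction v≡fresh v≢fresh) ] (bounded-or-fresh v∈xs)

fv-extremal : ∀ dir {ℓ} φ → L.All (_≤ ℓ) (fv φ) → L.All (_≤ ℓ) (fv (extremal dir ℓ φ))
fv-extremal dir {ℓ} φ fvφ≤ℓ = All-++⁺ fvφ≤ℓ (All-≤-filter-fresh bounded-or-fresh)
  where
  bounded-or-fresh : ∀ {v} → v ∈ fv (beyond dir (var 0) (var (suc ℓ))) ++ fv (rename (swap₀ ℓ) φ) →
    v ≤ ℓ ⊎ v ≡ suc ℓ
  bounded-or-fresh v∈ with ∈-++⁻ (fv (beyond dir (var 0) (var (suc ℓ)))) v∈
  ... | inj₁ v∈atom = map₁ (λ { refl → z≤n }) (fv-beyond dir v∈atom)
  ... | inj₂ v∈renamed with ∈-map⁻ (swap₀ ℓ) (fv-rename φ v∈renamed)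
  ...   | u , u∈ , refl = swap₀-bounded (L.lookup fvφ≤ℓ u∈)

P-extremal : ∀ dir {ℓ} φ → maxL (P (extremal dir ℓ φ)) ≡ maxL (P φ)
P-extremal dir {ℓ} φ
  rewrite coeffAtoms-rename (swap₀-injective ℓ) φ | modAtoms-rename {swap₀ ℓ} φ
        | modAtoms-beyond dir (var 0) (var (suc ℓ)) =
  maxL-cong-⊆ {(base ++ (C ++ (Cβ ++ C))) ++ map +_ (1 ∷ (M ++ M))} {P φ}
    (++⁺ (++-absorb-⊆ {xs = base} {C} (coeffAtoms-beyond dir ℓ))
         (map⁺ +_ (∷⁺ʳ 1 (++-⊆ {xs = M} ⊆-refl ⊆-refl))))
    (++⁺ (++⁺ʳ base (xs⊆xs++ys C (Cβ ++ C))) (map⁺ +_ (∷⁺ʳ 1 (xs⊆xs++ys M M))))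
  where
  C Cβ : List ℤ
  C = coeffAtoms φ
  Cβ = coeffAtoms (beyond dir (var 0) (var (suc ℓ)))
  M : List ℕ
  M = modAtoms φ

Const-extremal : ∀ dir {ℓ} φ → maxL (Const (extremal dir ℓ φ)) ≡ maxL (Const φ)
Const-extremal dir {ℓ} φ rewrite constAtoms-rename {swap₀ ℓ} φ =
  maxL-cong-⊆ {base ++ (K ++ (Kβ ++ K))} {Const φ}
    (++-absorb-⊆ {xs = base} {K} (constAtoms-beyond dir 0 (suc ℓ)))
    (++⁺ʳ base (xs⊆xs++ys K (Kβ ++ K)))
  where
  K Kβ : List ℤ
  K = constAtoms φ
  Kβ = constAtoms (beyond dir (var 0) (var (suc ℓ)))

bound-extremal : ∀ dir {ℓ} φ e N m → bound (extremal dir ℓ φ) e N m ≡ bound φ e N m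
bound-extremal dir φ e N m =
  cong₂ (λ p c → 2 ℕ.^ (∣ p ∣ ℕ.^ e) ℕ.* ∣ c ∣ ℕ.* N ℕ.* (1 ℕ.⊔ m))
        (P-extremal dir φ) (Const-extremal dir φ)

⟦extremal⟧ : ∀ dir {ℓ} φ → L.All (_≤ ℓ) (fv φ) → ∀ x (ns : Vec ℤ ℓ) →
  ⟦ extremal dir ℓ φ ⟧ (env x ns) ⇔ Maximal (Beyond dir) (λ z → ⟦ φ ⟧ (env z ns)) x
⟦extremal⟧ dir {ℓ} φ fvφ≤ℓ x ns =
  ⇔-refl ×-⇔ ¬-cong-⇔ (Σ-⇔ (↠-id ℤ) λ {b} →
    atom b ×-⇔ ⟦rename⟧ (swap₀-injective ℓ) φ (agree b))
  where
  open ≡-Reasoning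
  ρ : ℤ → ℕ → ℤ
  ρ b = env x ns [ suc ℓ ↦ b ]

  atom : ∀ b → ⟦ beyond dir (var 0) (var (suc ℓ)) ⟧ (ρ b) ⇔ Beyond dir x b
  atom b = ≡⇒⇔ (trans (⟦beyond⟧ dir (var 0) (var (suc ℓ)) (ρ b))
                      (cong (Beyond dir x) (update-≡ (env x ns) {suc ℓ})))

  agree : ∀ b {v} → v ∈ fv φ → env b ns v ≡ ρ b (swap₀ ℓ v)
  agree b {zero}  _  = sym (update-≡ (env x ns) {suc ℓ})
  agree b {suc u} v∈ = begin
    env b ns (suc u)        ≡⟨ env-suc b x ns u ⟩
    env x ns (suc u)        ≡⟨ sym (update-≢ (env x ns) (u≢ℓ ∘ ℕP.suc-injective)) ⟩
    ρ b (suc u)             ≡⟨ cong (ρ b) (sym (swap₀-fixes u≢ℓ)) ⟩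
    ρ b (swap₀ ℓ (suc u))   ∎
    where
    u≢ℓ : u ≢ ℓ
    u≢ℓ refl = ℕP.<-irrefl refl (L.lookup fvφ≤ℓ v∈)

BoundedWitnesses : ℕ → Set
BoundedWitnesses κ =
  ∀ (d' : ℕ) → 1 ≤ d' → (m : ℕ) (ψ : Formula) → qd ψ ≤ d' → L.All (λ v → v ≤ m) (fv ψ) →
  (M : ℕ) → 1 ≤ M → (ks : Vec ℤ m) → All (λ k → ∣ k ∣ ≤ M) ks →
  (⟦ ∃' 0 ψ ⟧ (env 0ℤ ks) → Σ ℤ λ k → ∣ k ∣ ≤ bound ψ (κ ^ d') M m × ⟦ ψ ⟧ (env k ks))
  × ((Σ ℤ λ k → ∣ k ∣ ≤ bound ψ (κ ^ d') M m × ⟦ ψ ⟧ (env k ks)) → ⟦ ∃' 0 ψ ⟧ (env 0ℤ ks))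

maximal-bounded : ∀ {κ} → BoundedWitnesses κ → ∀ dir {d ℓ} φ → qd φ ≤ d → L.All (_≤ ℓ) (fv φ) →
  ∀ {N} → 1 ≤ N → ∀ {ns : Vec ℤ ℓ} → All (λ k → ∣ k ∣ ≤ N) ns →
  ∀ {m} → Maximal (Beyond dir) (λ z → ⟦ φ ⟧ (env z ns)) m →
  Σ ℤ λ k → ∣ k ∣ ≤ bound φ (κ ^ suc d) N ℓ × Maximal (Beyond dir) (λ z → ⟦ φ ⟧ (env z ns)) k
maximal-bounded {κ} bounded dir {d} {ℓ} φ qdφ≤d fvφ≤ℓ {N} N≥1 {ns} ns≤N {m} m-max
  with proj₁ (bounded (suc d) (s≤s z≤n) ℓ (extremal dir ℓ φ) (qd-extremal dir φ qdφ≤d)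
                      (fv-extremal dir φ fvφ≤ℓ) N N≥1 ns ns≤N) (m , ψ-at-m)
  where
  ψ-at-m : ⟦ extremal dir ℓ φ ⟧ (env 0ℤ ns [ 0 ↦ m ])
  ψ-at-m = Equivalence.to (⟦⟧-coincidence (extremal dir ℓ φ) (λ {v} _ → env-update₀ 0ℤ m ns v))
                          (Equivalence.from (⟦extremal⟧ dir φ fvφ≤ℓ m ns) m-max)
... | k , |k|≤bound , ψ-at-k =
  k , subst (∣ k ∣ ≤_) (bound-extremal dir φ (κ ^ suc d) N ℓ) |k|≤bound ,
  Equivalence.to (⟦extremal⟧ dir φ fvφ≤ℓ k ns) ψ-at-k

lemma5p3 : (κ : ℕ) → 2 ≤ κ →
    (∀ (d' : ℕ) → 1 ≤ d' → (m : ℕ) (ψ : Formula) → qd ψ ≤ d' → L.All (λ v → v ≤ m) (fv ψ) →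
      (M : ℕ) → 1 ≤ M → (ks : Vec ℤ m) → All (λ k → ∣ k ∣ ≤ M) ks →
      (⟦ ∃' 0 ψ ⟧ (env 0ℤ ks) → Σ ℤ λ k → ∣ k ∣ ≤ bound ψ (κ ^ d') M m × ⟦ ψ ⟧ (env k ks))
      × ((Σ ℤ λ k → ∣ k ∣ ≤ bound ψ (κ ^ d') M m × ⟦ ψ ⟧ (env k ks)) → ⟦ ∃' 0 ψ ⟧ (env 0ℤ ks))) →
    (d : ℕ) → 1 ≤ d → (ℓ : ℕ) (φ : Formula) → qd φ ≤ d → L.All (λ v → v ≤ ℓ) (fv φ) →
    (N : ℕ) → 1 ≤ N → (ns : Vec ℤ ℓ) → All (λ k → ∣ k ∣ ≤ N) ns →
    (Σ (List ℤ) λ S → ∀ n → ⟦ φ ⟧ (env n ns) → n ∈ S) →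
    ∀ (n : ℤ) → ⟦ φ ⟧ (env n ns) → ∣ n ∣ ≤ bound φ (κ ^ suc d) N ℓ
lemma5p3 κ _ bounded d _ ℓ φ qdφ≤d fvφ≤ℓ N N≥1 ns ns≤N (S , cover) n φ-at-n =
  decidable-stable (∣ n ∣ ℕ.≤? bound φ (κ ^ suc d) N ℓ) λ |n|≰bound →
    ¬¬-maximal (Beyond-trans dir) (Beyond-irrefl dir) S (cover _) φ-at-n λ (m , m-max) →
      let k , |k|≤bound , k-max = maximal-bounded bounded dir φ qdφ≤d fvφ≤ℓ N≥1 ns≤N m-max
          |n|≤|k| = ¬Beyond⇒∣∣≤∣∣ n λ k-beyond-n → proj₂ k-max (n , k-beyond-n , φ-at-n)
      in |n|≰bound (ℕP.≤-trans |n|≤|k| |k|≤bound)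
  where
  dir : Sign
  dir = ℤ.sign n
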